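{- Let $1\leq i\leq k$ and $1\leq r\leq k-1$. For all $n\geq 0$: (i) if $n\equiv i+r-1\pmod{k}$ then $a_i$ is the first letter of $G_{n,r}$; (ii) if $n\equiv i-1\pmod{k}$ then $a_i$ is the last letter of $G_{n,r}$.
   Context: Fix $k\geq 2$, letters $a_1,\dots,a_k$ and positive integers $(d_i)_{i\geq1}$. Define $s_{1-k}=a_2,\dots,s_{ -1}=a_k,s_0=a_1$; $s_n=s_{n-1}^{d_n}\cdots s_0^{d_1}a_{n+1}$ for $1\leq n\leq k-1$; $s_n=s_{n-1}^{d_n}\cdots s_{n-k+1}^{d_{n-k+2}}s_{n-k}$ for $n\geq k$. Define $D_0=a_1^{d_1-1}$, $D_m=s_m^{d_{m+1}-1}s_{m-1}^{d_m}\cdots s_1^{d_2}s_0^{d_1}$ for $m\geq1$, and formally $D_{ -j}=a_{k+1-j}^{ -1}$ for $1\leq j\leq k$. Products involving inverse letters are computed in the free group on $\{a_1,\dots,a_k\}$. For $1\leq r\leq k-1$ and $n\geq0$, $G_{n,r}$ is defined by $s_n=D_{n-r}G_{n,r}$ (so $G_{n,r}=a_{k+1+n-r}s_n$ when $n<r$). -}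

module Defs where

open import Data.Nat using (ℕ; zero; suc; _+_; _∸_; _⊓_; _≡ᵇ_; _≤ᵇ_; _<ᵇ_)
open import Data.Bool using (Bool; true; false; if_then_else_; _∧_; not)
open import Data.List using (List; []; _∷_; _++_; map; concat; replicate; take; drop; upTo; foldr; reverse; zipWith)
open import Data.Product using (_×_; _,_; proj₁; proj₂)

-- Letters: the letter a_i is represented by the natural number i.
-- A positive word (over letters) is a List ℕ.
Word : Set
Word = List ℕ

pow : Word → ℕ → Word
pow w e = concat (replicate e w)

-- History: hist k d n = [ s_n , s_{n-1} , … , s_0 , s_{-1} , … , s_{1-k} ]
-- d i is d_i (only i ≥ 1 is used).
-- new term s_m (m ≥ 1) from h = [ s_{m-1} , s_{m-2} , … ]:
--   m ≤ k-1 : s_m = s_{m-1}^{d_m} ⋯ s_0^{d_1} a_{m+1}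
--   m ≥ k   : s_m = s_{m-1}^{d_m} ⋯ s_{m-k+1}^{d_{m-k+2}} s_{m-k}
newTerm : (k : ℕ) (d : ℕ → ℕ) (m : ℕ) → List Word → Word
newTerm k d m h =
  concat (zipWith pow (take t h) (map (λ j → d (m ∸ j)) (upTo t)))
  ++ (if m ≤ᵇ (k ∸ 1) then (suc m ∷ []) else concat (take 1 (drop (k ∸ 1) h)))
  where
  t : ℕ
  t = m ⊓ (k ∸ 1)

hist : (k : ℕ) (d : ℕ → ℕ) → ℕ → List Word
hist k d zero = (1 ∷ []) ∷ map (λ j → (k ∸ j) ∷ []) (upTo (k ∸ 1))
hist k d (suc n) = newTerm k d (suc n) (hist k d n) ∷ hist k d n

s : (k : ℕ) (d : ℕ → ℕ) → ℕ → Word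
s k d n = concat (take 1 (hist k d n))

-- D_m for m ≥ 0:  D_m = s_m^{d_{m+1}-1} s_{m-1}^{d_m} ⋯ s_0^{d_1}  (D_0 = a_1^{d_1 - 1})
D : (k : ℕ) (d : ℕ → ℕ) → ℕ → Word
D k d m = pow (s k d m) (d (suc m) ∸ 1)
       ++ concat (map (λ j → pow (s k d (m ∸ 1 ∸ j)) (d (m ∸ j))) (upTo m))

-- Free group on ℕ: words are lists of (letter , exponent sign), true = positive.
FWord : Set
FWord = List (ℕ × Bool)

embed : Word → FWord
embed = map (λ a → a , true)

invLetter : ℕ × Bool → ℕ × Bool
invLetter (a , b) = a , not b

inv : FWord → FWord
inv w = reverse (map invLetter w)

cancels : ℕ × Bool → ℕ × Bool → Bool
cancels (a , b) (a' , b') = (a ≡ᵇ a') ∧ not (b ≡B b')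
  where
  _≡B_ : Bool → Bool → Bool
  true ≡B true = true
  false ≡B false = true
  _ ≡B _ = false

reduce : FWord → FWord
reduce = foldr step []
  where
  step : ℕ × Bool → FWord → FWord
  step x [] = x ∷ []
  step x (y ∷ ys) = if cancels x y then ys else x ∷ y ∷ ys

-- Dfull k d n r = D_{n-r}, with the formal convention D_{-j} = a_{k+1-j}^{-1}
Dfull : (k : ℕ) (d : ℕ → ℕ) (n r : ℕ) → FWord
Dfull k d n r = if n <ᵇ r then ((k + 1 + n) ∸ r , false) ∷ [] else embed (D k d (n ∸ r))

-- G_{n,r} = D_{n-r}^{-1} s_n in the free group (reduced word), so that s_n = D_{n-r} G_{n,r}
G : (k : ℕ) (d : ℕ → ℕ) (n r : ℕ) → FWord
G k d n r = reduce (inv (Dfull k d n r) ++ embed (s k d n))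

firstLetter : FWord → List (ℕ × Bool)
firstLetter w = take 1 w

lastLetter : FWord → List (ℕ × Bool)
lastLetter w = take 1 (reverse w)

module Submission where

-- Write letter m = (m mod k) + 1.  The whole argument rests on two facts
-- about the words s_n, both proved by induction along the three shapes of
-- an index (n = 0, 1 ≤ n ≤ k-1, n = k + q):
--   (A) s_n ends with the letter a_{letter n};
--   (B) D_m a_{letter m} is a prefix of s_{m+1}.
-- For (B) one writes s_{m+1} = s_m^{d_{m+1}} R and D_m = s_m^{d_{m+1}-1} B_m
-- with B_m = s_{m-1}^{d_m} ⋯ s_0^{d_1}; for m = k + q the block B_m is
-- s_{m-1}^{d_m} ⋯ s_{q+1}^{d_{q+2}} followed by s_q D_q, which reduces (B)
-- for m to (B) for q.  Since s_m is a prefix of s_{m+1}, for r ≤ n we get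
-- s_n = D_{n-r} a_{letter (n-r)} W, hence G_{n,r} = a_{letter (n-r)} W after
-- free cancellation, while for n < r we have G_{n,r} = a_{k+1+n-r} s_n.
-- In both cases G_{n,r} starts with a_{letter j} for some j with
-- j + r ≡ n (mod k) and ends with the last letter of s_n, so the theorem
-- follows from (A) and the cancellation law for addition modulo k.

open import Defs
open import Data.Nat using (ℕ; zero; suc; _+_; _*_; _∸_; _≤_; _<_; _≤′_; ≤′-refl; ≤′-step; NonZero; z≤n; s≤s; s≤s⁻¹; _≡ᵇ_)
open import Data.Nat.Properties
open import Data.Nat.DivMod using (_%_; m<n⇒m%n≡m; [m+kn]%n≡m%n; [m+n]%n≡m%n; %-distribˡ-+)
open import Data.Nat.Induction using (<-rec)
open import Data.Bool using (true; false; if_then_else_; T)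
open import Data.Bool.Properties using (T-≡)
open import Data.Unit using (tt)
open import Data.List using (List; []; _∷_; _++_; [_]; map; concat; take; drop; upTo; zipWith; reverse)
open import Data.List.Properties using (++-assoc; ++-identityʳ; map-applyUpTo; map-cong; map-++; unfold-reverse)
open import Data.Product using (_×_; _,_; ∃)
open import Function using (_∘_; id)
open import Function.Bundles using (Equivalence)
open import Relation.Nullary using (¬_; yes; no; contradiction)
open import Relation.Binary.PropositionalEquality using (_≡_; refl; sym; trans; cong; cong₂; subst; subst₂; module ≡-Reasoning)
open ≡-Reasoning

≡true : ∀ {b} → T b → b ≡ true
≡true = Equivalence.to T-≡

≡false : ∀ {b} → ¬ T b → b ≡ false
≡false {false} _ = refl
≡false {true} ¬t = contradiction tt ¬t

reduce-embed : ∀ w → reduce (embed w) ≡ embed w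
reduce-embed [] = refl
reduce-embed (a ∷ []) = refl
reduce-embed (a ∷ b ∷ w) rewrite reduce-embed (b ∷ w) with a ≡ᵇ b
... | true = refl
... | false = refl

reduce-++ˡ : ∀ xs ys ys′ → reduce ys ≡ reduce ys′ → reduce (xs ++ ys) ≡ reduce (xs ++ ys′)
reduce-++ˡ [] ys ys′ e = e
reduce-++ˡ (x ∷ xs) ys ys′ e rewrite reduce-++ˡ xs ys ys′ e = refl

reduce-cancel-letter : ∀ a v → reduce ((a , false) ∷ (a , true) ∷ embed v) ≡ embed v
reduce-cancel-letter a v rewrite reduce-embed (a ∷ v) | ≡true (≡⇒≡ᵇ a a refl) = refl

reduce-inv-prefix : ∀ u w → reduce (inv (embed u) ++ embed (u ++ w)) ≡ embed w
reduce-inv-prefix [] w = reduce-embed w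
reduce-inv-prefix (a ∷ u) w = begin
    reduce (inv (embed (a ∷ u)) ++ embed (a ∷ u ++ w))
  ≡⟨ cong (λ v → reduce (v ++ embed (a ∷ u ++ w))) (unfold-reverse (a , false) (map invLetter (embed u))) ⟩
    reduce ((inv (embed u) ++ [ (a , false) ]) ++ embed (a ∷ u ++ w))
  ≡⟨ cong reduce (++-assoc (inv (embed u)) [ (a , false) ] (embed (a ∷ u ++ w))) ⟩
    reduce (inv (embed u) ++ (a , false) ∷ (a , true) ∷ embed (u ++ w))
  ≡⟨ reduce-++ˡ (inv (embed u)) _ _ (trans (reduce-cancel-letter a (u ++ w)) (sym (reduce-embed (u ++ w)))) ⟩
    reduce (inv (embed u) ++ embed (u ++ w))
  ≡⟨ reduce-inv-prefix u w ⟩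
    embed w
  ∎

take1-snoc-++ : ∀ {A : Set} (xs : List A) y ys → take 1 ((xs ++ [ y ]) ++ ys) ≡ take 1 (xs ++ [ y ])
take1-snoc-++ [] y ys = refl
take1-snoc-++ (x ∷ xs) y ys = refl

lastLetter-cons : ∀ x y ys → lastLetter (x ∷ y ∷ ys) ≡ lastLetter (y ∷ ys)
lastLetter-cons x y ys rewrite unfold-reverse x (y ∷ ys) | unfold-reverse y ys =
  take1-snoc-++ (reverse ys) y [ x ]

lastLetter-++ : ∀ u c w → lastLetter (u ++ c ∷ w) ≡ lastLetter (c ∷ w)
lastLetter-++ [] c w = refl
lastLetter-++ (x ∷ []) c w = lastLetter-cons x c w
lastLetter-++ (x ∷ y ∷ u) c w = trans (lastLetter-cons x y (u ++ c ∷ w)) (lastLetter-++ (y ∷ u) c w)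

lastLetter-snoc : ∀ v c → lastLetter (embed (v ++ [ c ])) ≡ [ (c , true) ]
lastLetter-snoc v c rewrite map-++ (λ a → a , true) v [ c ] = lastLetter-++ (embed v) (c , true) []

module Modular (k : ℕ) .{{_ : NonZero k}} where

  -- Translation by r is injective on residues modulo k: adding r(k-1) to
  -- both sides turns a + r into a + rk, which is congruent to a.
  %-cancel-+ʳ : ∀ a b r → (a + r) % k ≡ (b + r) % k → a % k ≡ b % k
  %-cancel-+ʳ a b r h = begin
      a % k                       ≡⟨ shift a ⟩
      (a + r + c) % k             ≡⟨ %-distribˡ-+ (a + r) c k ⟩
      ((a + r) % k + c % k) % k   ≡⟨ cong (λ v → (v + c % k) % k) h ⟩
      ((b + r) % k + c % k) % k   ≡⟨ sym (%-distribˡ-+ (b + r) c k) ⟩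
      (b + r + c) % k             ≡⟨ sym (shift b) ⟩
      b % k                       ∎
    where
    c : ℕ
    c = r * k ∸ r
    shift : ∀ x → x % k ≡ (x + r + c) % k
    shift x = begin
      x % k             ≡⟨ sym ([m+kn]%n≡m%n x r k) ⟩
      (x + r * k) % k   ≡⟨ cong (λ v → (x + v) % k) (sym (m+[n∸m]≡n (m≤m*n r k))) ⟩
      (x + (r + c)) % k ≡⟨ cong (_% k) (sym (+-assoc x r c)) ⟩
      (x + r + c) % k   ∎

open Modular using (%-cancel-+ʳ)

infix 4 _≼_
_≼_ : Word → Word → Set
u ≼ v = ∃ λ z → v ≡ u ++ z

≼-refl : ∀ u → u ≼ u
≼-refl u = [] , sym (++-identityʳ u)

≼-trans : ∀ {u v w} → u ≼ v → v ≼ w → u ≼ w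
≼-trans {u} (z₁ , refl) (z₂ , refl) = z₁ ++ z₂ , ++-assoc u z₁ z₂

++-≼ : ∀ w {u v} → u ≼ v → w ++ u ≼ w ++ v
++-≼ w {u} (z , refl) = z , sym (++-assoc w u z)

≼-pow : ∀ w e R → 1 ≤ e → w ≼ pow w e ++ R
≼-pow w (suc e) R _ = pow w e ++ R , ++-assoc w (pow w e) R

pow-suc : ∀ w e → pow w (suc e) ≡ pow w e ++ w
pow-suc w zero = ++-identityʳ w
pow-suc w (suc e) = trans (cong (w ++_) (pow-suc w e)) (sym (++-assoc w (pow w e) w))

-- The sequence for k = k₂ + 2 (written so that k ∸ 1 computes) and
-- exponents d_j ≥ 1.
module Sequence (k₂ : ℕ) (d : ℕ → ℕ) (d-pos : ∀ j → 1 ≤ j → 1 ≤ d j) where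

  k : ℕ
  k = suc (suc k₂)

  S : ℕ → Word
  S = s k d

  letter : ℕ → ℕ
  letter n = suc (n % k)

  letter-early : ∀ m → m ≤ k₂ → letter (suc m) ≡ suc (suc m)
  letter-early m m≤k₂ = cong suc (m<n⇒m%n≡m (s≤s (s≤s m≤k₂)))

  letter-late : ∀ q → letter (k + q) ≡ letter q
  letter-late q = cong suc (trans (cong (_% k) (+-comm k q)) ([m+n]%n≡m%n q k))

  block : ℕ → ℕ → Word
  block n zero = []
  block n (suc t) = pow (S (n ∸ 1)) (d n) ++ block (n ∸ 1) t

  block-++ : ∀ a b n → block n (a + b) ≡ block n a ++ block (n ∸ a) b
  block-++ zero b n = refl
  block-++ (suc a) b n rewrite block-++ a b (n ∸ 1) | ∸-+-assoc n 1 a =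
    sym (++-assoc (pow (S (n ∸ 1)) (d n)) (block (n ∸ 1) a) (block (n ∸ suc a) b))

  block-head : ∀ n t X → 1 ≤ n → 1 ≤ t → S (n ∸ 1) ≼ block n t ++ X
  block-head n (suc t) X 1≤n _ =
    subst (S (n ∸ 1) ≼_) (sym (++-assoc (pow (S (n ∸ 1)) (d n)) (block (n ∸ 1) t) X))
      (≼-pow (S (n ∸ 1)) (d n) _ (d-pos n 1≤n))

  drop-hist : ∀ j n → j ≤ n → drop j (hist k d n) ≡ hist k d (n ∸ j)
  drop-hist zero n _ = refl
  drop-hist (suc j) (suc n) (s≤s j≤n) = drop-hist j n j≤n

  newTerm-block : ∀ t n → t ≤ suc n →
    concat (zipWith pow (take t (hist k d n)) (map (λ j → d (suc n ∸ j)) (upTo t))) ≡ block (suc n) t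
  newTerm-block zero n _ = refl
  newTerm-block (suc zero) zero _ = refl
  newTerm-block (suc (suc t)) zero (s≤s ())
  newTerm-block (suc t) (suc n) t≤n =
    cong₂ (λ a b → pow a (d (suc (suc n))) ++ b) (sym (++-identityʳ _))
      (trans (cong (λ l → concat (zipWith pow (take t (hist k d n)) l))
                (trans (map-applyUpTo (id ∘ suc) (λ j → d (suc (suc n) ∸ j)) t)
                       (sym (map-applyUpTo id (λ j → d (suc n ∸ j)) t))))
             (newTerm-block t n (s≤s⁻¹ t≤n)))

  s-early : ∀ m → m ≤ k₂ → S (suc m) ≡ block (suc m) (suc m) ++ [ letter (suc m) ]
  s-early m m≤k₂ = trans unfold (cong (λ c → block (suc m) (suc m) ++ [ c ]) (sym (letter-early m m≤k₂)))
    where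
    unfold : S (suc m) ≡ block (suc m) (suc m) ++ [ suc (suc m) ]
    unfold rewrite m≤n⇒m⊓n≡m (s≤s m≤k₂) | m≤n⇒m⊓n≡m m≤k₂ | ≡true (≤⇒≤ᵇ (s≤s m≤k₂)) =
      trans (++-identityʳ _) (cong (_++ [ suc (suc m) ]) (newTerm-block (suc m) m ≤-refl))

  s-unfold-late : ∀ m → suc k₂ ≤ m → S (suc m) ≡ block (suc m) (suc k₂) ++ S (m ∸ suc k₂)
  s-unfold-late m k₂<m
    rewrite m≥n⇒m⊓n≡n (m≤n⇒m≤1+n k₂<m) | m≥n⇒m⊓n≡n (≤-trans (n≤1+n k₂) k₂<m)
          | ≡false (λ t → <⇒≱ (s≤s k₂<m) (≤ᵇ⇒≤ (suc m) (suc k₂) t)) | drop-hist (suc k₂) m k₂<m =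
    trans (++-identityʳ _) (cong (_++ S (m ∸ suc k₂)) (newTerm-block (suc k₂) m (m≤n⇒m≤1+n k₂<m)))

  s-late : ∀ q → S (k + q) ≡ block (k + q) (suc k₂) ++ S q
  s-late q = trans (s-unfold-late (suc k₂ + q) (m≤m+n (suc k₂) q))
    (cong (λ t → block (k + q) (suc k₂) ++ S t) (m+n∸m≡n (suc k₂) q))

  D-products : ∀ t m → concat (map (λ j → pow (S (m ∸ 1 ∸ j)) (d (m ∸ j))) (upTo t)) ≡ block m t
  D-products zero m = refl
  D-products (suc t) m = cong (pow (S (m ∸ 1)) (d m) ++_)
    (trans (cong concat
      (trans (map-applyUpTo (id ∘ suc) (λ j → pow (S (m ∸ 1 ∸ j)) (d (m ∸ j))) t)
      (trans (sym (map-applyUpTo id (λ j → pow (S (m ∸ 1 ∸ suc j)) (d (m ∸ suc j))) t))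
        (map-cong (λ j → cong₂ (λ a b → pow (S a) (d b)) (sym (∸-+-assoc (m ∸ 1) 1 j)) (sym (∸-+-assoc m 1 j))) (upTo t)))))
      (D-products t (m ∸ 1)))

  D-block : ∀ m → D k d m ≡ pow (S m) (d (suc m) ∸ 1) ++ block m m
  D-block m = cong (pow (S m) (d (suc m) ∸ 1) ++_) (D-products m m)

  block-full : ∀ q → block (suc q) (suc q) ≡ S q ++ D k d q
  block-full q = begin
      pow (S q) (d (suc q)) ++ block q q
    ≡⟨ cong (λ e → pow (S q) e ++ block q q) (sym (m+[n∸m]≡n (d-pos (suc q) (s≤s z≤n)))) ⟩
      (S q ++ pow (S q) (d (suc q) ∸ 1)) ++ block q q
    ≡⟨ ++-assoc (S q) _ _ ⟩
      S q ++ (pow (S q) (d (suc q) ∸ 1) ++ block q q)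
    ≡⟨ cong (S q ++_) (sym (D-block q)) ⟩
      S q ++ D k d q
    ∎

  block-late : ∀ q → block (k + q) (k + q) ≡ block (k + q) (suc k₂) ++ (S q ++ D k d q)
  block-late q = begin
      block (k + q) (k + q)
    ≡⟨ cong (λ n → block n n) (sym (+-suc (suc k₂) q)) ⟩
      block n′ n′
    ≡⟨ block-++ (suc k₂) (suc q) n′ ⟩
      block n′ (suc k₂) ++ block (n′ ∸ suc k₂) (suc q)
    ≡⟨ cong (λ n → block n′ (suc k₂) ++ block n (suc q)) (m+n∸m≡n (suc k₂) (suc q)) ⟩
      block n′ (suc k₂) ++ block (suc q) (suc q)
    ≡⟨ cong₂ _++_ (cong (λ n → block n (suc k₂)) (+-suc (suc k₂) q)) (block-full q) ⟩
      block (k + q) (suc k₂) ++ (S q ++ D k d q)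
    ∎
    where
    n′ : ℕ
    n′ = suc k₂ + suc q

  -- Indices by the shape of the recursion: 0, 1 ≤ n ≤ k-1, or k + q with q
  -- again classified.  Inductions along this view are strong inductions.
  data Position : ℕ → Set where
    start : Position 0
    early : ∀ m → m ≤ k₂ → Position (suc m)
    late  : ∀ {q} → Position q → Position (k + q)

  position : ∀ n → Position n
  position = <-rec Position classify
    where
    classify : ∀ n → (∀ {q} → q < n → Position q) → Position n
    classify zero _ = start
    classify (suc m) rec with m ≤? k₂
    ... | yes m≤k₂ = early m m≤k₂
    ... | no m≰k₂ = subst Position (cong suc (m+[n∸m]≡n (≰⇒> m≰k₂)))
                      (late (rec (s≤s (m∸n≤m m (suc k₂)))))

  s-≼-block-then-s : ∀ t q → S (t + q) ≼ block (suc (t + q)) t ++ S q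
  s-≼-block-then-s zero q = ≼-refl (S q)
  s-≼-block-then-s (suc t) q = block-head (suc (suc t + q)) (suc t) (S q) (s≤s z≤n) (s≤s z≤n)

  unfold-s : ∀ m → ∃ λ R → S (suc m) ≡ pow (S m) (d (suc m)) ++ R × (1 ≤ m → S (m ∸ 1) ≼ R)
  unfold-s m with position (suc m)
  ... | early .m m≤k₂ =
    block m m ++ [ letter (suc m) ] ,
    trans (s-early m m≤k₂) (++-assoc (pow (S m) (d (suc m))) (block m m) [ letter (suc m) ]) ,
    λ 1≤m → block-head m m [ letter (suc m) ] 1≤m 1≤m
  ... | late {q} _ =
    block (suc k₂ + q) k₂ ++ S q ,
    trans (s-late q) (++-assoc (pow (S (suc k₂ + q)) (d (k + q))) (block (suc k₂ + q) k₂) (S q)) ,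
    λ _ → s-≼-block-then-s k₂ q

  s-step-≼ : ∀ m → S m ≼ S (suc m)
  s-step-≼ m with unfold-s m
  ... | R , s-eq , _ = subst (S m ≼_) (sym s-eq) (≼-pow (S m) (d (suc m)) R (d-pos (suc m) (s≤s z≤n)))

  s-mono : ∀ {a b} → a ≤ b → S a ≼ S b
  s-mono a≤b = along (≤⇒≤′ a≤b)
    where
    along : ∀ {a b} → a ≤′ b → S a ≼ S b
    along ≤′-refl = ≼-refl _
    along (≤′-step {n} a≤n) = ≼-trans (along a≤n) (s-step-≼ n)

  s-ends : ∀ {n} → Position n → ∃ λ u → S n ≡ u ++ [ letter n ]
  s-ends start = [] , refl
  s-ends (early m m≤k₂) = block (suc m) (suc m) , s-early m m≤k₂
  s-ends (late {q} p) with s-ends p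
  ... | u , s-eq = A ++ u , (begin
      S (k + q)                  ≡⟨ s-late q ⟩
      A ++ S q                   ≡⟨ cong (A ++_) s-eq ⟩
      A ++ (u ++ [ letter q ])   ≡⟨ sym (++-assoc A u [ letter q ]) ⟩
      (A ++ u) ++ [ letter q ]   ≡⟨ cong (λ c → (A ++ u) ++ [ c ]) (sym (letter-late q)) ⟩
      (A ++ u) ++ [ letter (k + q) ] ∎)
    where
    A : Word
    A = block (k + q) (suc k₂)

  -- (B) D_m a_{letter m} is a prefix of s_{m+1}; it is proved together with
  -- its core: B_m a_{letter m} is a prefix of s_m R whenever R starts with s_{m-1}.
  D-letter-≼ : ∀ {m} → Position m → D k d m ++ [ letter m ] ≼ S (suc m)
  block-letter-≼ : ∀ {m} → Position m → ∀ R → (1 ≤ m → S (m ∸ 1) ≼ R) →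
    block m m ++ [ letter m ] ≼ S m ++ R

  D-letter-≼ {m} p with unfold-s m
  ... | R , s-eq , s≼R = subst₂ _≼_ (sym D-eq) (sym s-eq′) (++-≼ (pow (S m) e) (block-letter-≼ p R s≼R))
    where
    e : ℕ
    e = d (suc m) ∸ 1
    D-eq : D k d m ++ [ letter m ] ≡ pow (S m) e ++ (block m m ++ [ letter m ])
    D-eq = trans (cong (_++ [ letter m ]) (D-block m)) (++-assoc (pow (S m) e) (block m m) [ letter m ])
    s-eq′ : S (suc m) ≡ pow (S m) e ++ (S m ++ R)
    s-eq′ = begin
      S (suc m)                     ≡⟨ s-eq ⟩
      pow (S m) (d (suc m)) ++ R    ≡⟨ cong (λ f → pow (S m) f ++ R) (sym (m+[n∸m]≡n (d-pos (suc m) (s≤s z≤n)))) ⟩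
      pow (S m) (suc e) ++ R        ≡⟨ cong (_++ R) (pow-suc (S m) e) ⟩
      (pow (S m) e ++ S m) ++ R     ≡⟨ ++-assoc (pow (S m) e) (S m) R ⟩
      pow (S m) e ++ (S m ++ R)     ∎

  block-letter-≼ start R _ = R , refl
  block-letter-≼ (early m m≤k₂) R _ = R , cong (_++ R) (s-early m m≤k₂)
  block-letter-≼ (late {q} p) R s≼R = subst₂ _≼_ (sym block-eq) (sym s-eq)
    (++-≼ A (++-≼ (S q) (≼-trans (D-letter-≼ p) (≼-trans (s-mono (s≤s (m≤n+m q k₂))) (s≼R (s≤s z≤n))))))
    where
    A : Word
    A = block (k + q) (suc k₂)
    block-eq : block (k + q) (k + q) ++ [ letter (k + q) ] ≡ A ++ (S q ++ (D k d q ++ [ letter q ]))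
    block-eq = begin
      block (k + q) (k + q) ++ [ letter (k + q) ]   ≡⟨ cong₂ (λ b c → b ++ [ c ]) (block-late q) (letter-late q) ⟩
      (A ++ (S q ++ D k d q)) ++ [ letter q ]       ≡⟨ ++-assoc A (S q ++ D k d q) [ letter q ] ⟩
      A ++ ((S q ++ D k d q) ++ [ letter q ])       ≡⟨ cong (A ++_) (++-assoc (S q) (D k d q) [ letter q ]) ⟩
      A ++ (S q ++ (D k d q ++ [ letter q ]))       ∎
    s-eq : S (k + q) ++ R ≡ A ++ (S q ++ R)
    s-eq = trans (cong (_++ R) (s-late q)) (++-assoc A (S q) R)

  lastLetter-s : ∀ n → lastLetter (embed (S n)) ≡ [ (letter n , true) ]
  lastLetter-s n with s-ends (position n)
  ... | u , s-eq = trans (cong (lastLetter ∘ embed) s-eq) (lastLetter-snoc u (letter n))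

  G-before : ∀ n r → n < r → G k d n r ≡ embed ((k + 1 + n ∸ r) ∷ S n)
  G-before n r n<r = trans
    (cong (λ b → reduce (inv (if b then [ (k + 1 + n ∸ r , false) ] else embed (D k d (n ∸ r))) ++ embed (S n)))
          (≡true (<⇒<ᵇ n<r)))
    (reduce-embed ((k + 1 + n ∸ r) ∷ S n))

  -- For r ≤ n, s_n = D_{n-r} a_{letter (n-r)} W by (B), and G_{n,r} = a_{letter (n-r)} W.
  G-after : ∀ n r → 1 ≤ r → r ≤ n → ∃ λ W →
    G k d n r ≡ embed (letter (n ∸ r) ∷ W) × S n ≡ D k d (n ∸ r) ++ letter (n ∸ r) ∷ W
  G-after n r 1≤r r≤n with ≼-trans (D-letter-≼ (position (n ∸ r))) (s-mono (∸-monoʳ-< {n} {r} {0} 1≤r r≤n))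
  ... | W , s-eq = W , G-eq , s-eq′
    where
    Dₙᵣ : Word
    Dₙᵣ = D k d (n ∸ r)
    s-eq′ : S n ≡ Dₙᵣ ++ letter (n ∸ r) ∷ W
    s-eq′ = trans s-eq (++-assoc Dₙᵣ [ letter (n ∸ r) ] W)
    G-eq : G k d n r ≡ embed (letter (n ∸ r) ∷ W)
    G-eq = begin
        G k d n r
      ≡⟨ cong (λ b → reduce (inv (if b then [ (k + 1 + n ∸ r , false) ] else embed Dₙᵣ) ++ embed (S n)))
              (≡false (λ t → <⇒≱ (<ᵇ⇒< n r t) r≤n)) ⟩
        reduce (inv (embed Dₙᵣ) ++ embed (S n))
      ≡⟨ cong (λ w → reduce (inv (embed Dₙᵣ) ++ embed w)) s-eq′ ⟩
        reduce (inv (embed Dₙᵣ) ++ embed (Dₙᵣ ++ letter (n ∸ r) ∷ W))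
      ≡⟨ reduce-inv-prefix Dₙᵣ (letter (n ∸ r) ∷ W) ⟩
        embed (letter (n ∸ r) ∷ W)
      ∎

  G-first : ∀ n r → 1 ≤ r → r ≤ k → ∃ λ j → (j + r) % k ≡ n % k × firstLetter (G k d n r) ≡ [ (letter j , true) ]
  G-first n r 1≤r r≤k with n <? r
  ... | no n≮r with G-after n r 1≤r (≮⇒≥ n≮r)
  ...   | _ , G-eq , _ = n ∸ r , cong (_% k) (m∸n+n≡m (≮⇒≥ n≮r)) , cong firstLetter G-eq
  G-first n r 1≤r r≤k | yes n<r = j , j+r%k , trans (cong firstLetter (G-before n r n<r)) (cong (λ c → [ (c , true) ]) first-eq)
    where
    -- j = k + n - r, the residue of n - r, lies in [0, k) because n < r ≤ k.
    j : ℕ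
    j = k + n ∸ r
    r≤k+n : r ≤ k + n
    r≤k+n = ≤-trans r≤k (m≤m+n k n)
    j+r≡k+n : j + r ≡ k + n
    j+r≡k+n = m∸n+n≡m r≤k+n
    j<k : j < k
    j<k = +-cancelʳ-< r j k (subst (_< k + r) (sym j+r≡k+n) (+-monoʳ-< k n<r))
    j+r%k : (j + r) % k ≡ n % k
    j+r%k = trans (cong (_% k) (trans j+r≡k+n (+-comm k n))) ([m+n]%n≡m%n n k)
    first-eq : k + 1 + n ∸ r ≡ letter j
    first-eq = begin
      k + 1 + n ∸ r     ≡⟨ cong (λ x → x + n ∸ r) (+-comm k 1) ⟩
      1 + (k + n) ∸ r   ≡⟨ +-∸-assoc 1 r≤k+n ⟩
      suc j             ≡⟨ cong suc (sym (m<n⇒m%n≡m j<k)) ⟩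
      letter j          ∎

  G-last : ∀ n r → 1 ≤ r → lastLetter (G k d n r) ≡ [ (letter n , true) ]
  G-last n r 1≤r with n <? r
  ... | yes n<r with s-ends (position n)
  ...   | u , s-eq = begin
      lastLetter (G k d n r)                           ≡⟨ cong lastLetter (G-before n r n<r) ⟩
      lastLetter (embed ((k + 1 + n ∸ r) ∷ S n))       ≡⟨ cong (λ w → lastLetter (embed ((k + 1 + n ∸ r) ∷ w))) s-eq ⟩
      lastLetter (embed ((k + 1 + n ∸ r ∷ u) ++ [ letter n ])) ≡⟨ lastLetter-snoc (k + 1 + n ∸ r ∷ u) (letter n) ⟩
      [ (letter n , true) ]                            ∎
  G-last n r 1≤r | no n≮r with G-after n r 1≤r (≮⇒≥ n≮r)
  ...   | W , G-eq , s-eq = begin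
      lastLetter (G k d n r)                                    ≡⟨ cong lastLetter G-eq ⟩
      lastLetter (embed (c ∷ W))                                ≡⟨ sym (lastLetter-++ (embed Dₙᵣ) (c , true) (embed W)) ⟩
      lastLetter (embed Dₙᵣ ++ embed (c ∷ W))                   ≡⟨ cong lastLetter (sym (map-++ (λ a → a , true) Dₙᵣ (c ∷ W))) ⟩
      lastLetter (embed (Dₙᵣ ++ c ∷ W))                         ≡⟨ cong (lastLetter ∘ embed) (sym s-eq) ⟩
      lastLetter (embed (S n))                                  ≡⟨ lastLetter-s n ⟩
      [ (letter n , true) ]                                     ∎
    where
    c : ℕ
    c = letter (n ∸ r)
    Dₙᵣ : Word
    Dₙᵣ = D k d (n ∸ r)

-- With i = i₀ + 1: the first letter of G_{n,r} is a_{letter j} with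
-- j + r ≡ n ≡ i₀ + r, hence j ≡ i₀ (mod k); the last letter is a_{letter n}
-- with n ≡ i₀ (mod k).  Both equal a_{i₀ + 1} since i₀ < k.
proposition4p14 : (k : ℕ) → .{{_ : NonZero k}} → 2 ≤ k → (d : ℕ → ℕ) → (∀ j → 1 ≤ j → 1 ≤ d j) →
    (i r : ℕ) → 1 ≤ i → i ≤ k → 1 ≤ r → r ≤ k ∸ 1 → (n : ℕ) →
    (n % k ≡ (i + r ∸ 1) % k → firstLetter (G k d n r) ≡ (i , true) ∷ [])
    × (n % k ≡ (i ∸ 1) % k → lastLetter (G k d n r) ≡ (i , true) ∷ [])
proposition4p14 (suc (suc k₂)) (s≤s (s≤s z≤n)) d d-pos (suc i₀) r (s≤s z≤n) i₀<k 1≤r r≤k-1 n = first , last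
  where
  open Sequence k₂ d d-pos
  letter-i₀ : letter i₀ ≡ suc i₀
  letter-i₀ = cong suc (m<n⇒m%n≡m i₀<k)
  first : n % k ≡ (i₀ + r) % k → firstLetter (G k d n r) ≡ [ (suc i₀ , true) ]
  first n≡i₀+r with G-first n r 1≤r (m≤n⇒m≤1+n r≤k-1)
  ... | j , j+r≡n , G-starts = trans G-starts (cong (λ c → [ (c , true) ])
          (trans (cong suc (%-cancel-+ʳ k j i₀ r (trans j+r≡n n≡i₀+r))) letter-i₀))
  last : n % k ≡ i₀ % k → lastLetter (G k d n r) ≡ [ (suc i₀ , true) ]
  last n≡i₀ = trans (G-last n r 1≤r) (cong (λ c → [ (c , true) ]) (trans (cong suc n≡i₀) letter-i₀))
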